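{- Every convergent Chip Firing Game on a mutating graph (MCFG) is equivalent to a simple MCFG, that is, there is a simple MCFG whose configuration space is isomorphic, as a poset, to that of the given one.
   Context: An MCFG has a finite vertex set $V$. A position consists of three things: a directed multigraph on $V$; a nonnegative number of chips on each vertex; and, for each $v\in V$, an infinite sequence $M_v=(E_1(v),E_2(v),\ldots)$ of finite multisets of vertices, the mutation sequence of $v$. A vertex $v$ with at least one outgoing edge may be fired if it holds at least $d^+(v)$ chips, where $d^+(v)$ is its current outdegree. Firing sends one chip along each current outgoing edge of $v$. Then all outgoing edges of $v$ are removed, a new edge $(v,w)$ is created for each occurrence of $w$ in $E_1(v)$, and $E_1(v)$ is removed from $M_v$. The configuration space is the set of configurations reachable from the initial position, ordered by reachability. The game is convergent if it reaches a final configuration in which no firing is possible. An execution is a firing sequence from the initial configuration to the final one. A convergent game is simple if each vertex is fired at most once during an execution. Two convergent games are equivalent if their configuration spaces are isomorphic posets. -}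

module Defs where

open import Data.Nat using (ℕ; zero; suc; _+_; _∸_; _≤_; _<_)
open import Data.Fin using (Fin; _≟_)
open import Data.Vec using (sum; tabulate)
open import Data.List using (List; []; _∷_)
open import Data.List.Relation.Unary.Unique.Propositional using (Unique)
open import Data.Product using (Σ; _×_; ∃; ∃-syntax; _,_)
open import Data.Unit using (⊤)
open import Relation.Nullary using (¬_; yes; no)
open import Relation.Binary.PropositionalEquality using (_≡_)
open import Relation.Binary.Morphism.Structures using (IsOrderIsomorphism)

-- A position of an MCFG on the vertex set Fin n (finite vertex set).
--   graph u w   = multiplicity of the edge (u , w) in the current multigraph
--   chips u     = number of chips on u
--   mut u i w   = multiplicity of w in the multiset E_{i+1}(u) of the
--                 (remaining) mutation sequence M_u = (E_1(u), E_2(u), ...)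
record Position (n : ℕ) : Set where
  constructor position
  field
    graph : Fin n → Fin n → ℕ
    chips : Fin n → ℕ
    mut   : Fin n → ℕ → Fin n → ℕ
open Position public

-- An MCFG is given by its initial position.
MCFG : ℕ → Set
MCFG = Position

_≈_ : ∀ {n} → Position n → Position n → Set
p ≈ q = (∀ u w → graph p u w ≡ graph q u w)
      × (∀ u → chips p u ≡ chips q u)
      × (∀ u i w → mut p u i w ≡ mut q u i w)

outdeg : ∀ {n} → Position n → Fin n → ℕ
outdeg p v = sum (tabulate (graph p v))

CanFire : ∀ {n} → Position n → Fin n → Set
CanFire p v = 0 < outdeg p v × outdeg p v ≤ chips p v

fire : ∀ {n} → Position n → Fin n → Position n
fire p v = position g c m
  where
  g : _
  g u w with u ≟ v
  ... | yes _ = mut p v 0 w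
  ... | no  _ = graph p u w
  c : _
  c u with u ≟ v
  ... | yes _ = (chips p u ∸ outdeg p v) + graph p v u
  ... | no  _ = chips p u + graph p v u
  m : _
  m u i with u ≟ v
  ... | yes _ = mut p v (suc i)
  ... | no  _ = mut p u i

fireSeq : ∀ {n} → Position n → List (Fin n) → Position n
fireSeq p []       = p
fireSeq p (v ∷ vs) = fireSeq (fire p v) vs

Legal : ∀ {n} → Position n → List (Fin n) → Set
Legal p []       = ⊤
Legal p (v ∷ vs) = CanFire p v × Legal (fire p v) vs

Reach : ∀ {n} → Position n → Position n → Set
Reach p q = ∃[ vs ] (Legal p vs × fireSeq p vs ≈ q)

Final : ∀ {n} → Position n → Set
Final p = ∀ v → ¬ CanFire p v

Config : ∀ {n} → MCFG n → Set
Config G = Σ (Position _) (λ p → Reach G p)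

_≈C_ : ∀ {n} {G : MCFG n} → Config G → Config G → Set
(p , _) ≈C (q , _) = p ≈ q

_≤C_ : ∀ {n} {G : MCFG n} → Config G → Config G → Set
(p , _) ≤C (q , _) = Reach p q

Convergent : ∀ {n} → MCFG n → Set
Convergent G = ∃[ p ] (Reach G p × Final p)

Execution : ∀ {n} → MCFG n → List (Fin n) → Set
Execution G vs = Legal G vs × Final (fireSeq G vs)

Simple : ∀ {n} → MCFG n → Set
Simple G = Convergent G × (∀ vs → Execution G vs → Unique vs)

Equivalent : ∀ {n m} → MCFG n → MCFG m → Set
Equivalent G H = ∃[ f ] IsOrderIsomorphism (_≈C_ {G = G}) (_≈C_ {G = H}) (_≤C_ {G = G}) (_≤C_ {G = H}) f

-- Firing is abelian: the position reached by a legal sequence depends only on its firing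
-- vector (how often each vertex fired), and a legal sequence from a smaller firing vector can be
-- replayed from a larger one.  Hence, in a convergent game every reachable firing vector lies
-- below the final one, configurations correspond bijectively to reachable firing vectors, and
-- reachability becomes the pointwise order.  The simple game has a vertex (w, l) for each
-- vertex w and each l up to the length of an execution, standing for the (l+1)-st firing of w;
-- its mutation sequences are empty, so each vertex fires at most once, and its weights let
-- (w, l) fire exactly when w has fired l times and could fire once more.  Sending a firing
-- vector x to the set of copies {(w, l) | l < x w} then identifies the two configuration spaces.
module Submission where

open import Defs
open import Data.Nat using (ℕ; zero; suc; _+_; _*_; _∸_; _⊓_; _⊔_; _≤_; _<_; z≤n; s≤s; _<?_; _≤?_)
open import Data.Nat.Properties hiding (_≟_)
open import Data.Fin using (Fin; zero; suc; toℕ; _≟_; combine; quotient; remainder; _↑ˡ_; _↑ʳ_)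
import Data.Fin.Properties as FP
import Data.Vec as Vec
open import Data.List using (List; []; _∷_; _++_; length)
open import Data.List.Relation.Unary.All using (All; []; _∷_)
import Data.List.Relation.Unary.All as All
open import Data.List.Relation.Unary.AllPairs using ([]; _∷_)
open import Data.List.Relation.Unary.Unique.Propositional using (Unique)
open import Data.Product using (Σ; _×_; _,_; proj₁; proj₂; ∃-syntax)
open import Data.Sum using (inj₁; inj₂)
open import Data.Unit using (⊤; tt)
open import Data.Empty using (⊥-elim)
open import Relation.Nullary using (¬_; yes; no)
open import Relation.Binary.PropositionalEquality
open import Relation.Binary.Morphism.Structures using (IsOrderIsomorphism)
open import Algebra.Properties.CommutativeSemigroup +-commutativeSemigroup using (interchange)
open import Algebra.Properties.Semiring.Sum +-*-semiring
  using (sum; sum-cong-≗; ∑-distrib-+; *-distribˡ-sum; sum-replicate-zero)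

-- Finite sums

sum-tabulate : ∀ {n} (f : Fin n → ℕ) → Vec.sum (Vec.tabulate f) ≡ sum f
sum-tabulate {zero}  f = refl
sum-tabulate {suc n} f = cong (f zero +_) (sum-tabulate (λ i → f (suc i)))

sum-mono-≤ : ∀ {n} {f g : Fin n → ℕ} → (∀ i → f i ≤ g i) → sum f ≤ sum g
sum-mono-≤ {zero}  f≤g = z≤n
sum-mono-≤ {suc n} f≤g = +-mono-≤ (f≤g zero) (sum-mono-≤ (λ i → f≤g (suc i)))

sum-const : ∀ n c → sum {n} (λ _ → c) ≡ n * c
sum-const zero    c = refl
sum-const (suc n) c = cong (c +_) (sum-const n c)

sum-↑ : ∀ k {n} (f : Fin (k + n) → ℕ) →
        sum f ≡ sum (λ i → f (i ↑ˡ n)) + sum (λ j → f (k ↑ʳ j))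
sum-↑ zero    f = refl
sum-↑ (suc k) f = trans (cong (f zero +_) (sum-↑ k (λ i → f (suc i))))
                        (sym (+-assoc (f zero) _ _))

sum-combine : ∀ m k (f : Fin (m * k) → ℕ) →
              sum f ≡ sum {m} (λ i → sum {k} (λ j → f (combine i j)))
sum-combine zero    k f = refl
sum-combine (suc m) k f =
  trans (sum-↑ k f) (cong (sum (λ j → f (j ↑ˡ (m * k))) +_) (sum-combine m k (λ i → f (k ↑ʳ i))))

δ : ∀ {n} → Fin n → Fin n → ℕ → ℕ
δ zero    zero    a = a
δ zero    (suc _) a = 0
δ (suc _) zero    a = 0
δ (suc u) (suc v) a = δ u v a

δ-diag : ∀ {n} (v : Fin n) a → δ v v a ≡ a
δ-diag zero    a = refl
δ-diag (suc v) a = δ-diag v a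

δ-off : ∀ {n} {u v : Fin n} a → ¬ u ≡ v → δ u v a ≡ 0
δ-off {u = zero}  {zero}  a u≢v = ⊥-elim (u≢v refl)
δ-off {u = zero}  {suc v} a u≢v = refl
δ-off {u = suc u} {zero}  a u≢v = refl
δ-off {u = suc u} {suc v} a u≢v = δ-off a (λ u≡v → u≢v (cong suc u≡v))

δ-comm : ∀ {n} (u v : Fin n) a → δ u v a ≡ δ v u a
δ-comm zero    zero    a = refl
δ-comm zero    (suc v) a = refl
δ-comm (suc u) zero    a = refl
δ-comm (suc u) (suc v) a = δ-comm u v a

*-δ : ∀ {n} (u v : Fin n) a c → a * δ u v c ≡ δ u v (a * c)
*-δ zero    zero    a c = refl
*-δ zero    (suc v) a c = *-zeroʳ a
*-δ (suc u) zero    a c = *-zeroʳ a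
*-δ (suc u) (suc v) a c = *-δ u v a c

sum-δʳ : ∀ {n} (v : Fin n) (c : Fin n → ℕ) → sum (λ u → δ u v (c u)) ≡ c v
sum-δʳ {suc n} zero    c = trans (cong (c zero +_) (sum-replicate-zero n)) (+-identityʳ _)
sum-δʳ {suc n} (suc v) c = sum-δʳ v (λ u → c (suc u))

sum-δˡ : ∀ {n} (v : Fin n) (c : Fin n → ℕ) → sum (λ u → δ v u (c u)) ≡ c v
sum-δˡ v c = trans (sum-cong-≗ (λ u → δ-comm v u (c u))) (sum-δʳ v c)

prefixSum : ℕ → (ℕ → ℕ) → ℕ
prefixSum zero    g = 0
prefixSum (suc k) g = prefixSum k g + g k

prefixSum-mono-≤ : ∀ (g : ℕ → ℕ) {k k′} → k ≤ k′ → prefixSum k g ≤ prefixSum k′ g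
prefixSum-mono-≤ g {k′ = zero}   z≤n = ≤-refl
prefixSum-mono-≤ g {k′ = suc k′} k≤1+k′ with m≤n⇒m<n∨m≡n k≤1+k′
... | inj₁ (s≤s k≤k′) = ≤-trans (prefixSum-mono-≤ g k≤k′) (m≤m+n _ _)
... | inj₂ refl       = ≤-refl

prefixSum-suc : ∀ k (g : ℕ → ℕ) → prefixSum (suc k) g ≡ g 0 + prefixSum k (λ j → g (suc j))
prefixSum-suc zero    g = +-comm 0 (g 0)
prefixSum-suc (suc k) g = trans (cong (_+ g (suc k)) (prefixSum-suc k g)) (+-assoc (g 0) _ _)

prefixSum-+ : ∀ k (g h : ℕ → ℕ) → prefixSum k (λ j → g j + h j) ≡ prefixSum k g + prefixSum k h
prefixSum-+ zero    g h = refl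
prefixSum-+ (suc k) g h = begin
  prefixSum k (λ j → g j + h j) + (g k + h k)  ≡⟨ cong (_+ (g k + h k)) (prefixSum-+ k g h) ⟩
  (prefixSum k g + prefixSum k h) + (g k + h k) ≡⟨ interchange (prefixSum k g) _ _ _ ⟩
  (prefixSum k g + g k) + (prefixSum k h + h k) ∎
  where open ≡-Reasoning

prefixSum-const : ∀ k c → prefixSum k (λ _ → c) ≡ k * c
prefixSum-const zero    c = refl
prefixSum-const (suc k) c = trans (cong (_+ c) (prefixSum-const k c)) (+-comm (k * c) c)

prefixSum-≤1 : ∀ k (g : ℕ → ℕ) → k ≤ 1 → prefixSum k g ≡ k * g 0
prefixSum-≤1 zero          g _ = refl
prefixSum-≤1 (suc zero)    g _ = sym (+-identityʳ (g 0))
prefixSum-≤1 (suc (suc k)) g (s≤s ())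

below : ℕ → ℕ → ℕ
below l       zero    = 0
below zero    (suc a) = 1
below (suc l) (suc a) = below l a

below-≥ : ∀ {l a} → a ≤ l → below l a ≡ 0
below-≥ {a = zero}          _         = refl
below-≥ {suc l} {suc a} (s≤s a≤l) = below-≥ a≤l

below-< : ∀ {l a} → l < a → below l a ≡ 1
below-< {zero}  {suc a} _         = refl
below-< {suc l} {suc a} (s≤s l<a) = below-< l<a

below-≤1 : ∀ l a → below l a ≤ 1
below-≤1 l a with l <? a
... | yes l<a = ≤-reflexive (below-< l<a)
... | no  l≮a = subst (_≤ 1) (sym (below-≥ (≮⇒≥ l≮a))) z≤n

below-suc : ∀ {l a} → ¬ l ≡ a → below l a ≡ below l (suc a)
below-suc {zero}  {zero}  l≢a = ⊥-elim (l≢a refl)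
below-suc {zero}  {suc a} l≢a = refl
below-suc {suc l} {zero}  l≢a = refl
below-suc {suc l} {suc a} l≢a = below-suc (λ l≡a → l≢a (cong suc l≡a))

below-monoʳ-≤ : ∀ l {a a′} → a ≤ a′ → below l a ≤ below l a′
below-monoʳ-≤ l       {zero}  a≤a′      = z≤n
below-monoʳ-≤ zero    {suc a} (s≤s _)   = ≤-refl
below-monoʳ-≤ (suc l) {suc a} (s≤s a≤a′) = below-monoʳ-≤ l a≤a′

sum-below : ∀ K {a} → a ≤ K → (g : ℕ → ℕ) →
            sum {K} (λ l → below (toℕ l) a * g (toℕ l)) ≡ prefixSum a g
sum-below zero    {zero}  z≤n      g = refl
sum-below (suc K) {zero}  _        g = sum-replicate-zero K
sum-below (suc K) {suc a} (s≤s a≤K) g = begin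
  g 0 + 0 + sum {K} (λ l → below (toℕ l) a * g (suc (toℕ l)))
    ≡⟨ cong₂ _+_ (+-identityʳ (g 0)) (sum-below K a≤K (λ j → g (suc j))) ⟩
  g 0 + prefixSum a (λ j → g (suc j))
    ≡⟨ prefixSum-suc a g ⟨
  prefixSum (suc a) g ∎
  where open ≡-Reasoning

clamp : ∀ L → ℕ → Fin (suc L)
clamp L       zero    = zero
clamp zero    (suc a) = zero
clamp (suc L) (suc a) = suc (clamp L a)

toℕ-clamp : ∀ {L a} → a ≤ L → toℕ (clamp L a) ≡ a
toℕ-clamp {L}     {zero}  _         = refl
toℕ-clamp {suc L} {suc a} (s≤s a≤L) = cong suc (toℕ-clamp a≤L)

1⊓m*n>0⇒m>0 : ∀ m {n} → 0 < (1 ⊓ m) * n → 0 < m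
1⊓m*n>0⇒m>0 (suc m) _ = s≤s z≤n

m>0⇒1⊓m*n≡n : ∀ {m} n → 0 < m → (1 ⊓ m) * n ≡ n
m>0⇒1⊓m*n≡n {suc m} n _ = +-identityʳ n

digit-forced : ∀ {b t x r s} → r < b → x ≤ t → b * t + s ≤ r + x * b → t ≡ x × s ≤ r
digit-forced {b} {t} {x} {r} {s} r<b x≤t bt+s≤r+xb with m≤n⇒m<n∨m≡n x≤t
... | inj₂ refl = refl , +-cancelˡ-≤ (b * x) s r (subst (b * x + s ≤_) r+xb≡bx+r bt+s≤r+xb)
  where
  r+xb≡bx+r : r + x * b ≡ b * x + r
  r+xb≡bx+r = trans (+-comm r (x * b)) (cong (_+ r) (*-comm x b))
... | inj₁ x<t = ⊥-elim (<⇒≱ r+xb<bt (≤-trans (m≤m+n (b * t) s) bt+s≤r+xb))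
  where
  r+xb<bt : r + x * b < b * t
  r+xb<bt = begin-strict
    r + x * b   <⟨ +-monoˡ-< (x * b) r<b ⟩
    b + x * b   ≡⟨ cong (b +_) (*-comm x b) ⟩
    b + b * x   ≡⟨ *-suc b x ⟨
    b * suc x   ≤⟨ *-monoʳ-≤ b x<t ⟩
    b * t       ∎
    where open ≤-Reasoning

≈-refl : ∀ {n} {p : Position n} → p ≈ p
≈-refl = (λ _ _ → refl) , (λ _ → refl) , (λ _ _ _ → refl)

≈-sym : ∀ {n} {p q : Position n} → p ≈ q → q ≈ p
≈-sym (g , c , m) = (λ u w → sym (g u w)) , (λ u → sym (c u)) , (λ u i w → sym (m u i w))

≈-trans : ∀ {n} {p q r : Position n} → p ≈ q → q ≈ r → p ≈ r
≈-trans (g , c , m) (g′ , c′ , m′) =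
  (λ u w → trans (g u w) (g′ u w)) , (λ u → trans (c u) (c′ u)) , (λ u i w → trans (m u i w) (m′ u i w))

outdeg-sum : ∀ {n} (p : Position n) v → outdeg p v ≡ sum (graph p v)
outdeg-sum p v = sum-tabulate (graph p v)

outdeg-cong : ∀ {n} {p q : Position n} → p ≈ q → ∀ v → outdeg p v ≡ outdeg q v
outdeg-cong {p = p} {q} (g≡ , _ , _) v =
  trans (outdeg-sum p v) (trans (sum-cong-≗ (g≡ v)) (sym (outdeg-sum q v)))

fire-cong : ∀ {n} {p q : Position n} → p ≈ q → ∀ v → fire p v ≈ fire q v
fire-cong {p = p} {q} p≈q@(g≡ , c≡ , m≡) v = graph≡ , chips≡ , mut≡
  where
  graph≡ : ∀ u w → graph (fire p v) u w ≡ graph (fire q v) u w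
  graph≡ u w with u ≟ v
  ... | yes _ = m≡ v 0 w
  ... | no  _ = g≡ u w
  chips≡ : ∀ u → chips (fire p v) u ≡ chips (fire q v) u
  chips≡ u with u ≟ v
  ... | yes _ = cong₂ _+_ (cong₂ _∸_ (c≡ u) (outdeg-cong p≈q v)) (g≡ v u)
  ... | no  _ = cong₂ _+_ (c≡ u) (g≡ v u)
  mut≡ : ∀ u i w → mut (fire p v) u i w ≡ mut (fire q v) u i w
  mut≡ u i w with u ≟ v
  ... | yes _ = m≡ v (suc i) w
  ... | no  _ = m≡ u i w

CanFire-cong : ∀ {n} {p q : Position n} → p ≈ q → ∀ v → CanFire p v → CanFire q v
CanFire-cong p≈q@(_ , c≡ , _) v (out>0 , out≤chips) =
  subst (0 <_) (outdeg-cong p≈q v) out>0 , subst₂ _≤_ (outdeg-cong p≈q v) (c≡ v) out≤chips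

Legal-cong : ∀ {n} {p q : Position n} → p ≈ q → ∀ vs → Legal p vs → Legal q vs
Legal-cong p≈q []       _               = tt
Legal-cong p≈q (v ∷ vs) (canFire , legal) =
  CanFire-cong p≈q v canFire , Legal-cong (fire-cong p≈q v) vs legal

fireSeq-cong : ∀ {n} {p q : Position n} → p ≈ q → ∀ vs → fireSeq p vs ≈ fireSeq q vs
fireSeq-cong p≈q []       = p≈q
fireSeq-cong p≈q (v ∷ vs) = fireSeq-cong (fire-cong p≈q v) vs

Reach-cong : ∀ {n} {p p′ q q′ : Position n} → p ≈ p′ → q ≈ q′ → Reach p q → Reach p′ q′
Reach-cong p≈p′ q≈q′ (vs , legal , end) =
  vs , Legal-cong p≈p′ vs legal , ≈-trans (≈-trans (fireSeq-cong (≈-sym p≈p′) vs) end) q≈q′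

-- Firing vectors

_≤̇_ : ∀ {n} → (Fin n → ℕ) → (Fin n → ℕ) → Set
x ≤̇ y = ∀ v → x v ≤ y v

zeros : ∀ {n} → Fin n → ℕ
zeros _ = 0

inc : ∀ {n} → (Fin n → ℕ) → Fin n → Fin n → ℕ
inc x v u with u ≟ v
... | yes _ = suc (x u)
... | no  _ = x u

inc-self : ∀ {n} (x : Fin n → ℕ) v → inc x v v ≡ suc (x v)
inc-self x v with v ≟ v
... | yes _   = refl
... | no  v≢v = ⊥-elim (v≢v refl)

inc-cong : ∀ {n} {x y : Fin n → ℕ} → x ≗ y → ∀ v → inc x v ≗ inc y v
inc-cong x≗y v u with u ≟ v
... | yes _ = cong suc (x≗y u)
... | no  _ = x≗y u

inc-≥ : ∀ {n} (x : Fin n → ℕ) v → x ≤̇ inc x v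
inc-≥ x v u with u ≟ v
... | yes _ = n≤1+n _
... | no  _ = ≤-refl

inc-zeros : ∀ {n} (x : Fin n → ℕ) v u → inc x v u ≡ x u + inc zeros v u
inc-zeros x v u with u ≟ v
... | yes _ = sym (+-comm (x u) 1)
... | no  _ = sym (+-identityʳ (x u))

incAll : ∀ {n} → (Fin n → ℕ) → List (Fin n) → Fin n → ℕ
incAll x []       = x
incAll x (v ∷ vs) = incAll (inc x v) vs

incAll-cong : ∀ {n} {x y : Fin n → ℕ} → x ≗ y → ∀ vs → incAll x vs ≗ incAll y vs
incAll-cong x≗y []       = x≗y
incAll-cong x≗y (v ∷ vs) = incAll-cong (inc-cong x≗y v) vs

incAll-≥ : ∀ {n} (x : Fin n → ℕ) vs → x ≤̇ incAll x vs
incAll-≥ x []       u = ≤-refl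
incAll-≥ x (v ∷ vs) u = ≤-trans (inc-≥ x v u) (incAll-≥ (inc x v) vs u)

incAll-++ : ∀ {n} (x : Fin n → ℕ) us vs → incAll x (us ++ vs) ≡ incAll (incAll x us) vs
incAll-++ x []       vs = refl
incAll-++ x (u ∷ us) vs = incAll-++ (inc x u) us vs

incAll-zeros : ∀ {n} (x : Fin n → ℕ) vs u → incAll x vs u ≡ x u + incAll zeros vs u
incAll-zeros x []       u = sym (+-identityʳ (x u))
incAll-zeros x (v ∷ vs) u = begin
  incAll (inc x v) vs u                              ≡⟨ incAll-zeros (inc x v) vs u ⟩
  inc x v u + incAll zeros vs u                      ≡⟨ cong (_+ incAll zeros vs u) (inc-zeros x v u) ⟩
  x u + inc zeros v u + incAll zeros vs u            ≡⟨ +-assoc (x u) _ _ ⟩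
  x u + (inc zeros v u + incAll zeros vs u)          ≡⟨ cong (x u +_) (incAll-zeros (inc zeros v) vs u) ⟨
  x u + incAll (inc zeros v) vs u                    ∎
  where open ≡-Reasoning

incAll-zeros-≤-length : ∀ {n} (vs : List (Fin n)) u → incAll zeros vs u ≤ length vs
incAll-zeros-≤-length []       u = z≤n
incAll-zeros-≤-length (v ∷ vs) u = begin
  incAll (inc zeros v) vs u        ≡⟨ incAll-zeros (inc zeros v) vs u ⟩
  inc zeros v u + incAll zeros vs u ≤⟨ +-mono-≤ (inc-zeros-≤1 u) (incAll-zeros-≤-length vs u) ⟩
  1 + length vs                     ∎
  where
  open ≤-Reasoning
  inc-zeros-≤1 : ∀ u → inc zeros v u ≤ 1
  inc-zeros-≤1 u with u ≟ v
  ... | yes _ = ≤-refl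
  ... | no  _ = z≤n

module FiringVectors {n : ℕ} (G : MCFG n) where

  graphAfter : ℕ → Fin n → Fin n → ℕ
  graphAfter zero    v = graph G v
  graphAfter (suc j) v = mut G v j

  degAfter : ℕ → Fin n → ℕ
  degAfter j v = sum (graphAfter j v)

  sent : ℕ → Fin n → ℕ
  sent k v = prefixSum k (λ j → degAfter j v)

  inflow : (Fin n → ℕ) → Fin n → ℕ
  inflow x w = sum (λ u → prefixSum (x u) (λ j → graphAfter j u w))

  income : (Fin n → ℕ) → Fin n → ℕ
  income x w = chips G w + inflow x w

  -- The chip count uses truncated subtraction; it is the true count only under Solvent.
  positionAt : (Fin n → ℕ) → Position n
  positionAt x = position (λ v → graphAfter (x v) v)
                          (λ v → income x v ∸ sent (x v) v)
                          (λ v i → mut G v (x v + i))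

  Solvent : (Fin n → ℕ) → Set
  Solvent x = ∀ v → sent (x v) v ≤ income x v

  Fireable : (Fin n → ℕ) → Fin n → Set
  Fireable x v = 0 < degAfter (x v) v × sent (suc (x v)) v ≤ income x v

  Playable : (Fin n → ℕ) → List (Fin n) → Set
  Playable x []       = ⊤
  Playable x (v ∷ vs) = Fireable x v × Playable (inc x v) vs

  income-cong : ∀ {x y} → x ≗ y → income x ≗ income y
  income-cong x≗y w =
    cong (chips G w +_) (sum-cong-≗ (λ u → cong (λ k → prefixSum k (λ j → graphAfter j u w)) (x≗y u)))

  income-mono : ∀ {x y} → x ≤̇ y → income x ≤̇ income y
  income-mono x≤y w =
    +-monoʳ-≤ (chips G w) (sum-mono-≤ (λ u → prefixSum-mono-≤ (λ j → graphAfter j u w) (x≤y u)))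

  positionAt-cong : ∀ {x y} → x ≗ y → positionAt x ≈ positionAt y
  positionAt-cong x≗y = (λ v w → cong (λ k → graphAfter k v w) (x≗y v))
                      , (λ v → cong₂ _∸_ (income-cong x≗y v) (cong (λ k → sent k v) (x≗y v)))
                      , (λ v i w → cong (λ k → mut G v (k + i) w) (x≗y v))

  Fireable-cong : ∀ {x y} → x ≗ y → ∀ v → Fireable x v → Fireable y v
  Fireable-cong {x} {y} x≗y v fireable rewrite x≗y v =
    subst (λ c → 0 < degAfter (y v) v × sent (suc (y v)) v ≤ c) (income-cong x≗y v) fireable

  Solvent-cong : ∀ {x y} → x ≗ y → Solvent x → Solvent y
  Solvent-cong x≗y solvent v =
    subst₂ _≤_ (cong (λ k → sent k v) (x≗y v)) (income-cong x≗y v) (solvent v)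

  Playable-cong : ∀ {x y} → x ≗ y → ∀ vs → Playable x vs → Playable y vs
  Playable-cong x≗y []       _                    = tt
  Playable-cong x≗y (v ∷ vs) (fireable , playable) =
    Fireable-cong x≗y v fireable , Playable-cong (inc-cong x≗y v) vs playable

  Fireable-mono : ∀ {x y} v → x ≤̇ y → x v ≡ y v → Fireable x v → Fireable y v
  Fireable-mono v x≤y xv≡yv (deg>0 , enough) rewrite xv≡yv =
    deg>0 , ≤-trans enough (income-mono x≤y v)

  prefixSum-inc : ∀ (x : Fin n → ℕ) v u (g : ℕ → ℕ) →
                  prefixSum (inc x v u) g ≡ prefixSum (x u) g + δ u v (g (x u))
  prefixSum-inc x v u g with u ≟ v
  ... | yes refl = cong (prefixSum (x u) g +_) (sym (δ-diag u _))
  ... | no  u≢v  = trans (sym (+-identityʳ _)) (cong (prefixSum (x u) g +_) (sym (δ-off _ u≢v)))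

  income-inc : ∀ x v w → income (inc x v) w ≡ income x w + graphAfter (x v) v w
  income-inc x v w = begin
    chips G w + sum (λ u → prefixSum (inc x v u) (λ j → graphAfter j u w))
      ≡⟨ cong (chips G w +_) (sum-cong-≗ (λ u → prefixSum-inc x v u (λ j → graphAfter j u w))) ⟩
    chips G w + sum (λ u → prefixSum (x u) (λ j → graphAfter j u w) + δ u v (graphAfter (x u) u w))
      ≡⟨ cong (chips G w +_) (∑-distrib-+ (λ u → prefixSum (x u) (λ j → graphAfter j u w)) _) ⟩
    chips G w + (inflow x w + sum (λ u → δ u v (graphAfter (x u) u w)))
      ≡⟨ cong (λ t → chips G w + (inflow x w + t)) (sum-δʳ v (λ u → graphAfter (x u) u w)) ⟩
    chips G w + (inflow x w + graphAfter (x v) v w)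
      ≡⟨ +-assoc (chips G w) _ _ ⟨
    income x w + graphAfter (x v) v w ∎
    where open ≡-Reasoning

  outdeg-positionAt : ∀ x v → outdeg (positionAt x) v ≡ degAfter (x v) v
  outdeg-positionAt x v = outdeg-sum (positionAt x) v

  fire-positionAt : ∀ x v → Solvent x → sent (suc (x v)) v ≤ income x v →
                    fire (positionAt x) v ≈ positionAt (inc x v)
  fire-positionAt x v solvent enough = graph≡ , chips≡ , mut≡
    where
    graph≡ : ∀ u w → graph (fire (positionAt x) v) u w ≡ graph (positionAt (inc x v)) u w
    graph≡ u w with u ≟ v
    ... | yes refl = cong (λ k → mut G u k w) (+-identityʳ (x u))
    ... | no  _    = refl
    chips≡ : ∀ u → chips (fire (positionAt x) v) u ≡ chips (positionAt (inc x v)) u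
    chips≡ u with u ≟ v
    ... | yes refl = begin
      (income x u ∸ sent (x u) u) ∸ outdeg (positionAt x) u + graphAfter (x u) u u
        ≡⟨ cong (λ d → (income x u ∸ sent (x u) u) ∸ d + graphAfter (x u) u u) (outdeg-positionAt x u) ⟩
      (income x u ∸ sent (x u) u) ∸ degAfter (x u) u + graphAfter (x u) u u
        ≡⟨ cong (_+ graphAfter (x u) u u) (∸-+-assoc (income x u) (sent (x u) u) _) ⟩
      income x u ∸ sent (suc (x u)) u + graphAfter (x u) u u
        ≡⟨ +-∸-comm _ enough ⟨
      (income x u + graphAfter (x u) u u) ∸ sent (suc (x u)) u
        ≡⟨ cong (_∸ sent (suc (x u)) u) (income-inc x u u) ⟨
      income (inc x u) u ∸ sent (suc (x u)) u ∎
      where open ≡-Reasoning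
    ... | no  _ = trans (sym (+-∸-comm _ (solvent u))) (cong (_∸ sent (x u) u) (sym (income-inc x v u)))
    mut≡ : ∀ u i w → mut (fire (positionAt x) v) u i w ≡ mut (positionAt (inc x v)) u i w
    mut≡ u i w with u ≟ v
    ... | yes refl = cong (λ k → mut G u k w) (+-suc (x u) i)
    ... | no  _    = refl

  Solvent-inc : ∀ x v → Solvent x → Fireable x v → Solvent (inc x v)
  Solvent-inc x v solvent (_ , enough) u with u ≟ v
  ... | yes refl = ≤-trans enough (income-mono (inc-≥ x u) u)
  ... | no  _    = ≤-trans (solvent u) (income-mono (inc-≥ x v) u)

  Solvent-zeros : Solvent zeros
  Solvent-zeros v = z≤n

  Fireable⇒CanFire : ∀ x v → Fireable x v → CanFire (positionAt x) v
  Fireable⇒CanFire x v (deg>0 , enough) rewrite outdeg-positionAt x v =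
    deg>0 , subst (_≤ income x v ∸ sent (x v) v) (m+n∸m≡n (sent (x v) v) _) (∸-monoˡ-≤ (sent (x v) v) enough)

  CanFire⇒Fireable : ∀ x v → Solvent x → CanFire (positionAt x) v → Fireable x v
  CanFire⇒Fireable x v solvent (deg>0 , enough) rewrite outdeg-positionAt x v =
    deg>0 , subst (sent (suc (x v)) v ≤_) (m+[n∸m]≡n (solvent v)) (+-monoʳ-≤ (sent (x v) v) enough)

  Playable⇒Legal : ∀ x vs → Solvent x → Playable x vs →
                   Legal (positionAt x) vs × fireSeq (positionAt x) vs ≈ positionAt (incAll x vs)
  Playable⇒Legal x []       solvent _                     = tt , ≈-refl
  Playable⇒Legal x (v ∷ vs) solvent (fireable , playable) =
    (Fireable⇒CanFire x v fireable , Legal-cong (≈-sym fired) vs legal) ,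
    ≈-trans (fireSeq-cong fired vs) end
    where
    fired = fire-positionAt x v solvent (proj₂ fireable)
    rest  = Playable⇒Legal (inc x v) vs (Solvent-inc x v solvent fireable) playable
    legal = proj₁ rest
    end   = proj₂ rest

  Legal⇒Playable : ∀ x vs → Solvent x → Legal (positionAt x) vs → Playable x vs
  Legal⇒Playable x []       solvent _                 = tt
  Legal⇒Playable x (v ∷ vs) solvent (canFire , legal) =
    fireable , Legal⇒Playable (inc x v) vs (Solvent-inc x v solvent fireable)
                 (Legal-cong (fire-positionAt x v solvent (proj₂ fireable)) vs legal)
    where fireable = CanFire⇒Fireable x v solvent canFire

  Playable-Solvent : ∀ x vs → Solvent x → Playable x vs → Solvent (incAll x vs)
  Playable-Solvent x []       solvent _                     = solvent
  Playable-Solvent x (v ∷ vs) solvent (fireable , playable) =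
    Playable-Solvent (inc x v) vs (Solvent-inc x v solvent fireable) playable

  Playable-++ : ∀ x us vs → Playable x us → Playable (incAll x us) vs → Playable x (us ++ vs)
  Playable-++ x []       vs _                      playable = playable
  Playable-++ x (u ∷ us) vs (fireable , playable₁) playable₂ =
    fireable , Playable-++ (inc x u) us vs playable₁ playable₂

  initial≈positionAt-zeros : G ≈ positionAt zeros
  initial≈positionAt-zeros =
    (λ _ _ → refl) ,
    (λ v → sym (trans (cong (λ t → chips G v + t) (sum-replicate-zero n)) (+-identityʳ _))) ,
    (λ _ _ _ → refl)

  Reachable : (Fin n → ℕ) → Set
  Reachable x = Σ (List (Fin n)) λ vs → Playable zeros vs × incAll zeros vs ≗ x

  Reachable-zeros : Reachable zeros
  Reachable-zeros = [] , tt , λ _ → refl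

  Reachable-Solvent : ∀ {x} → Reachable x → Solvent x
  Reachable-Solvent (vs , playable , end) =
    Solvent-cong end (Playable-Solvent zeros vs Solvent-zeros playable)

  Reachable-++ : ∀ {x} → Reachable x → ∀ us → Playable x us → Reachable (incAll x us)
  Reachable-++ {x} (vs , playable , end) us playableᵤ =
    vs ++ us ,
    Playable-++ zeros vs us playable (Playable-cong (λ u → sym (end u)) us playableᵤ) ,
    λ u → trans (cong (λ f → f u) (incAll-++ zeros vs us)) (incAll-cong end us u)

  Reachable-inc : ∀ {x} → Reachable x → ∀ v → Fireable x v → Reachable (inc x v)
  Reachable-inc reachable v fireable = Reachable-++ reachable (v ∷ []) (fireable , tt)

  -- A legal sequence from a ≤ x can be replayed from x, skipping the firings x already contains.
  Playable-join : ∀ a x ws → Playable a ws → a ≤̇ x →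
                  Σ (List (Fin n)) λ us → Playable x us × (incAll x us ≗ λ u → x u ⊔ incAll a ws u)
  Playable-join a x []       _                     a≤x = [] , tt , λ u → sym (m≥n⇒m⊔n≡m (a≤x u))
  Playable-join a x (w ∷ ws) (fireable , playable) a≤x with a w <? x w
  ... | yes aw<xw = Playable-join (inc a w) x ws playable inc-a≤x
    where
    inc-a≤x : inc a w ≤̇ x
    inc-a≤x u with u ≟ w
    ... | yes refl = aw<xw
    ... | no  _    = a≤x u
  ... | no  aw≮xw = w ∷ us , (Fireable-mono w a≤x aw≡xw fireable , playableᵤ) , λ u → trans (end u) (absorb u)
    where
    aw≡xw = ≤-antisym (a≤x w) (≮⇒≥ aw≮xw)
    inc-a≤inc-x : inc a w ≤̇ inc x w
    inc-a≤inc-x u with u ≟ w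
    ... | yes refl = s≤s (a≤x u)
    ... | no  _    = a≤x u
    joined = Playable-join (inc a w) (inc x w) ws playable inc-a≤inc-x
    us = proj₁ joined
    playableᵤ = proj₁ (proj₂ joined)
    end = proj₂ (proj₂ joined)
    rest = incAll (inc a w) ws
    absorb : ∀ u → inc x w u ⊔ rest u ≡ x u ⊔ rest u
    absorb u with u ≟ w
    ... | no  _    = refl
    ... | yes refl = trans (m≤n⇒m⊔n≡n xu<rest) (sym (m≤n⇒m⊔n≡n (≤-trans (n≤1+n _) xu<rest)))
      where
      xu<rest : suc (x u) ≤ rest u
      xu<rest = subst (_≤ rest u) (trans (inc-self a u) (cong suc aw≡xw)) (incAll-≥ (inc a u) ws u)

  Active : (Fin n → ℕ) → Set
  Active x = ∀ w j → j < x w → 0 < degAfter j w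

  Active-inc : ∀ x v → Active x → Fireable x v → Active (inc x v)
  Active-inc x v active (deg>0 , _) w j j<x with w ≟ v
  ... | no  _    = active w j j<x
  ... | yes refl with m≤n⇒m<n∨m≡n (≤-pred j<x)
  ...   | inj₁ j<xw  = active w j j<xw
  ...   | inj₂ refl = deg>0

  Active-incAll : ∀ x vs → Active x → Playable x vs → Active (incAll x vs)
  Active-incAll x []       active _                     = active
  Active-incAll x (v ∷ vs) active (fireable , playable) =
    Active-incAll (inc x v) vs (Active-inc x v active fireable) playable

  Reachable-Active : ∀ {x} → Reachable x → Active x
  Reachable-Active (vs , playable , end) w j j<x =
    Active-incAll zeros vs (λ _ _ ()) playable w j (subst (j <_) (sym (end w)) j<x)

  firingVector : Config G → Fin n → ℕ
  firingVector (_ , vs , _) = incAll zeros vs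

  config-Playable : (c : Config G) → Playable zeros (proj₁ (proj₂ c))
  config-Playable (_ , vs , legal , _) =
    Legal⇒Playable zeros vs Solvent-zeros (Legal-cong initial≈positionAt-zeros vs legal)

  config-Reachable : (c : Config G) → Reachable (firingVector c)
  config-Reachable c@(_ , vs , _) = vs , config-Playable c , λ _ → refl

  config≈positionAt : (c : Config G) → proj₁ c ≈ positionAt (firingVector c)
  config≈positionAt c@(_ , vs , _ , end) =
    ≈-trans (≈-sym end)
      (≈-trans (fireSeq-cong initial≈positionAt-zeros vs)
               (proj₂ (Playable⇒Legal zeros vs Solvent-zeros (config-Playable c))))

  configOf : ∀ vs → Playable zeros vs → Config G
  configOf vs playable =
    fireSeq G vs ,
    vs , Legal-cong (≈-sym initial≈positionAt-zeros) vs (proj₁ (Playable⇒Legal zeros vs Solvent-zeros playable)) ,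
    ≈-refl

  Stuck : (Fin n → ℕ) → Set
  Stuck x = ∀ v → ¬ Fireable x v

  Stuck⇒Final : ∀ x → Solvent x → Stuck x → Final (positionAt x)
  Stuck⇒Final x solvent stuck v canFire = stuck v (CanFire⇒Fireable x v solvent canFire)

  stuckExecution : Convergent G → Σ (List (Fin n)) λ vs → Playable zeros vs × Stuck (incAll zeros vs)
  stuckExecution (p , reach , final) =
    proj₁ reach , config-Playable c ,
    λ v fireable → final v (CanFire-cong (≈-sym (config≈positionAt c)) v
                                         (Fireable⇒CanFire (firingVector c) v fireable))
    where c = (p , reach)

  stuck⇒Convergent : ∀ vs → Playable zeros vs → Stuck (incAll zeros vs) → Convergent G
  stuck⇒Convergent vs playable stuck =
    proj₁ c , proj₂ c ,
    λ v canFire → Stuck⇒Final (firingVector c) (Reachable-Solvent (config-Reachable c)) stuck v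
                    (CanFire-cong (config≈positionAt c) v canFire)
    where c = configOf vs playable

  ≗⇒≈C : ∀ c d → firingVector c ≗ firingVector d → c ≈C d
  ≗⇒≈C c d c≗d = ≈-trans (config≈positionAt c) (≈-trans (positionAt-cong c≗d) (≈-sym (config≈positionAt d)))

  Playable-Unique : (∀ j v → degAfter (suc j) v ≡ 0) → ∀ x vs → Playable x vs → Unique vs
  Playable-Unique no-edges = unique
    where
    unfired : ∀ {x v} → Fireable x v → x v ≡ 0
    unfired {x} {v} (deg>0 , _) with x v
    ... | zero  = refl
    ... | suc j = ⊥-elim (<-irrefl refl (subst (0 <_) (no-edges j v) deg>0))
    all-unfired : ∀ x vs → Playable x vs → All (λ v → x v ≡ 0) vs
    all-unfired x []       _                     = []
    all-unfired x (v ∷ vs) (fireable , playable) =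
      unfired {x} fireable ∷ All.map (λ {u} incxu≡0 → n≤0⇒n≡0 (subst (x u ≤_) incxu≡0 (inc-≥ x v u)))
                                 (all-unfired (inc x v) vs playable)
    unique : ∀ x vs → Playable x vs → Unique vs
    unique x []       _                     = []
    unique x (v ∷ vs) (fireable , playable) =
      All.map (λ {u} incxu≡0 v≡u → 0≢1+n (trans (sym incxu≡0) (trans (cong (inc x v) (sym v≡u)) (inc-self x v))))
              (all-unfired (inc x v) vs playable)
      ∷ unique (inc x v) vs playable

  module Convergence (fs : List (Fin n)) (fs-playable : Playable zeros fs)
                     (fs-stuck : Stuck (incAll zeros fs)) where

    final : Fin n → ℕ
    final = incAll zeros fs

    ≤-final : ∀ {x} → Reachable x → x ≤̇ final
    ≤-final {x} (xs , playable , end) u with Playable-join zeros final xs playable (λ _ → z≤n)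
    ... | []    , _              , joined =
      subst (_≤ final u) (end u) (subst (incAll zeros xs u ≤_) (sym (joined u)) (m≤n⊔m (final u) _))
    ... | w ∷ _ , (fireable , _) , _      = ⊥-elim (fs-stuck w fireable)

    -- The continuation us from x to final is also legal from y, so y + us ≤ final = x + us.
    positionAt-injective-≥ : ∀ {x y} → Reachable x → Reachable y → positionAt x ≈ positionAt y → y ≤̇ x
    positionAt-injective-≥ {x} {y} reachableˣ reachableʸ x≈y u =
      +-cancelʳ-≤ (incAll zeros us u) (y u) (x u)
        (subst₂ _≤_ (incAll-zeros y us u) (incAll-zeros x us u) y+us≤x+us)
      where
      joined = Playable-join zeros x fs fs-playable (λ _ → z≤n)
      us = proj₁ joined
      playableˣ = proj₁ (proj₂ joined)
      legal = proj₁ (Playable⇒Legal x us (Reachable-Solvent reachableˣ) playableˣ)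
      playableʸ = Legal⇒Playable y us (Reachable-Solvent reachableʸ) (Legal-cong x≈y us legal)
      y+us≤x+us : incAll y us u ≤ incAll x us u
      y+us≤x+us = ≤-trans (≤-final (Reachable-++ reachableʸ us playableʸ) u)
                          (subst (final u ≤_) (sym (proj₂ (proj₂ joined) u)) (m≤n⊔m (x u) (final u)))

    positionAt-injective : ∀ {x y} → Reachable x → Reachable y → positionAt x ≈ positionAt y → x ≗ y
    positionAt-injective reachableˣ reachableʸ x≈y u =
      ≤-antisym (positionAt-injective-≥ reachableʸ reachableˣ (≈-sym x≈y) u)
                (positionAt-injective-≥ reachableˣ reachableʸ x≈y u)

    Reach⇒≤̇ : ∀ {x y} → Reachable x → Reachable y → Reach (positionAt x) (positionAt y) → x ≤̇ y
    Reach⇒≤̇ {x} reachableˣ reachableʸ (us , legal , end) u =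
      subst (x u ≤_) (x+us≗y u) (incAll-≥ x us u)
      where
      solvent = Reachable-Solvent reachableˣ
      playable = Legal⇒Playable x us solvent legal
      x+us≗y = positionAt-injective (Reachable-++ reachableˣ us playable) reachableʸ
                 (≈-trans (≈-sym (proj₂ (Playable⇒Legal x us solvent playable))) end)

    ≤̇⇒Reach : ∀ {x y} → Reachable x → Reachable y → x ≤̇ y → Reach (positionAt x) (positionAt y)
    ≤̇⇒Reach {x} {y} reachableˣ (ys , playableʸ , endʸ) x≤y =
      us , proj₁ replayed , ≈-trans (proj₂ replayed) (positionAt-cong x+us≗y)
      where
      joined = Playable-join zeros x ys playableʸ (λ _ → z≤n)
      us = proj₁ joined
      replayed = Playable⇒Legal x us (Reachable-Solvent reachableˣ) (proj₁ (proj₂ joined))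
      x+us≗y : incAll x us ≗ y
      x+us≗y u = trans (proj₂ (proj₂ joined) u) (trans (cong (x u ⊔_) (endʸ u)) (m≤n⇒m⊔n≡n (x≤y u)))

    ≈C⇒≗ : ∀ c d → c ≈C d → firingVector c ≗ firingVector d
    ≈C⇒≗ c d c≈d = positionAt-injective (config-Reachable c) (config-Reachable d)
                     (≈-trans (≈-sym (config≈positionAt c)) (≈-trans c≈d (config≈positionAt d)))

    ≤C⇒≤̇ : ∀ c d → c ≤C d → firingVector c ≤̇ firingVector d
    ≤C⇒≤̇ c d c≤d = Reach⇒≤̇ (config-Reachable c) (config-Reachable d)
                      (Reach-cong (config≈positionAt c) (config≈positionAt d) c≤d)

    ≤̇⇒≤C : ∀ c d → firingVector c ≤̇ firingVector d → c ≤C d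
    ≤̇⇒≤C c d c≤d = Reach-cong (≈-sym (config≈positionAt c)) (≈-sym (config≈positionAt d))
                      (≤̇⇒Reach (config-Reachable c) (config-Reachable d) c≤d)

-- The simple game

module SimpleGame {n : ℕ} (G : MCFG n) (fs : List (Fin n))
                  (fs-playable : FiringVectors.Playable G zeros fs)
                  (fs-stuck : FiringVectors.Stuck G (incAll zeros fs)) where

  open FiringVectors G
  open Convergence fs fs-playable fs-stuck

  L : ℕ
  L = length fs

  K : ℕ
  K = suc L

  Reachable-≤-L : ∀ {x} → Reachable x → ∀ w → x w ≤ L
  Reachable-≤-L reachable w =
    ≤-trans (≤-final reachable w) (incAll-zeros-≤-length fs w)

  bound : Fin n → ℕ
  bound w = suc (income final w)

  income<bound : ∀ {x} → Reachable x → ∀ w → income x w < bound w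
  income<bound reachable w = s≤s (income-mono (≤-final reachable) w)

  m : ℕ
  m = n * K

  vertexOf : Fin m → Fin n
  vertexOf = quotient K

  levelOf : Fin m → Fin K
  levelOf = remainder {n} K

  -- Each firing of w gives every copy of w bound w chips, more than any reachable income, so
  -- the self-loop threshold of (w, l) is met exactly when w has fired l times and has the
  -- chips for its (l+1)-st firing.  The factor 1 ⊓ d removes all edges when that firing has none.
  row : Fin n → Fin K → Fin n → ℕ
  row w l w′ = graphAfter (toℕ l) w w′ + δ w′ w (bound w)

  threshold : Fin n → Fin K → ℕ
  threshold w l = bound w * toℕ l + sent (suc (toℕ l)) w

  edges : Fin n → Fin K → Fin m → ℕ
  edges w l e = (1 ⊓ degAfter (toℕ l) w) * (row w l (vertexOf e) + δ e (combine w l) (threshold w l))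

  initialChips : Fin n → Fin K → ℕ
  initialChips w l = K * degAfter (toℕ l) w + K * bound w + chips G w

  H : MCFG m
  H = position (λ e → edges (vertexOf e) (levelOf e))
               (λ e → initialChips (vertexOf e) (levelOf e))
               (λ _ _ _ → 0)

  module HF = FiringVectors H

  vertexOf-combine : ∀ w l → vertexOf (combine w l) ≡ w
  vertexOf-combine w l = cong proj₁ (FP.remQuot-combine w l)

  combine-vertexOf-levelOf : ∀ e → combine (vertexOf e) (levelOf e) ≡ e
  combine-vertexOf-levelOf e = FP.combine-remQuot {n} K e

  graphH-combine : ∀ w l → HF.graphAfter 0 (combine w l) ≗ edges w l
  graphH-combine w l e = cong (λ (w , l) → edges w l e) (FP.remQuot-combine w l)

  chipsH-combine : ∀ w l → chips H (combine w l) ≡ initialChips w l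
  chipsH-combine w l = cong (λ (w , l) → initialChips w l) (FP.remQuot-combine w l)

  degH-suc : ∀ j e → HF.degAfter (suc j) e ≡ 0
  degH-suc j e = sum-replicate-zero m

  degH-combine : ∀ w l → HF.degAfter 0 (combine w l) ≡
                 (1 ⊓ degAfter (toℕ l) w) * (K * degAfter (toℕ l) w + K * bound w + threshold w l)
  degH-combine w l = begin
    sum (HF.graphAfter 0 (combine w l))
      ≡⟨ sum-cong-≗ (graphH-combine w l) ⟩
    sum (edges w l)
      ≡⟨ *-distribˡ-sum (1 ⊓ d) (λ e → row w l (vertexOf e) + δ e (combine w l) (threshold w l)) ⟨
    (1 ⊓ d) * sum (λ e → row w l (vertexOf e) + δ e (combine w l) (threshold w l))
      ≡⟨ cong ((1 ⊓ d) *_) (trans (∑-distrib-+ (λ e → row w l (vertexOf e)) _)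
                                  (cong₂ _+_ sum-rows (sum-δʳ (combine w l) (λ _ → threshold w l)))) ⟩
    (1 ⊓ d) * (K * d + K * bound w + threshold w l) ∎
    where
    open ≡-Reasoning
    d = degAfter (toℕ l) w
    sum-rows : sum (λ e → row w l (vertexOf e)) ≡ K * d + K * bound w
    sum-rows = begin
      sum (λ e → row w l (vertexOf e))
        ≡⟨ sum-combine n K (λ e → row w l (vertexOf e)) ⟩
      sum {n} (λ w′ → sum {K} (λ l′ → row w l (vertexOf (combine w′ l′))))
        ≡⟨ sum-cong-≗ (λ w′ → trans (sum-cong-≗ (λ l′ → cong (row w l) (vertexOf-combine w′ l′)))
                                     (sum-const K _)) ⟩
      sum {n} (λ w′ → K * row w l w′)
        ≡⟨ *-distribˡ-sum K (row w l) ⟨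
      K * sum (row w l)
        ≡⟨ cong (K *_) (trans (∑-distrib-+ (graphAfter (toℕ l) w) _) (cong (d +_) (sum-δʳ w (λ _ → bound w)))) ⟩
      K * (d + bound w)
        ≡⟨ *-distribˡ-+ K d (bound w) ⟩
      K * d + K * bound w ∎

  lift : (Fin n → ℕ) → Fin m → ℕ
  lift x e = below (toℕ (levelOf e)) (x (vertexOf e))

  lift-combine : ∀ x w l → lift x (combine w l) ≡ below (toℕ l) (x w)
  lift-combine x w l = cong (λ (w , l) → below (toℕ l) (x w)) (FP.remQuot-combine w l)

  -- A fired copy has positive degree (x is active) and is not the unfired copy itself.
  fired-edge : ∀ {x} → Active x → ∀ {w l} → x w ≤ toℕ l → ∀ w₁ l₁ →
               below (toℕ l₁) (x w₁) * edges w₁ l₁ (combine w l) ≡ below (toℕ l₁) (x w₁) * row w₁ l₁ w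
  fired-edge {x} active {w} {l} unfired w₁ l₁ with toℕ l₁ <? x w₁
  ... | no  l₁≮x rewrite below-≥ (≮⇒≥ l₁≮x) = refl
  ... | yes l₁<x = cong (below (toℕ l₁) (x w₁) *_) (begin
    (1 ⊓ degAfter (toℕ l₁) w₁) * out  ≡⟨ cong (_* out) (m≤n⇒m⊓n≡m (active w₁ (toℕ l₁) l₁<x)) ⟩
    1 * out                           ≡⟨ *-identityˡ out ⟩
    out                               ≡⟨ cong₂ _+_ (cong (row w₁ l₁) (vertexOf-combine w l)) (δ-off _ distinct) ⟩
    row w₁ l₁ w + 0                   ≡⟨ +-identityʳ _ ⟩
    row w₁ l₁ w                       ∎)
    where
    open ≡-Reasoning
    out = row w₁ l₁ (vertexOf (combine w l)) + δ (combine w l) (combine w₁ l₁) (threshold w₁ l₁)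
    distinct : ¬ combine w l ≡ combine w₁ l₁
    distinct eq with FP.combine-injective w l w₁ l₁ eq
    ... | refl , refl = <⇒≱ l₁<x unfired

  inflowH-unfired : ∀ {x} → Reachable x → ∀ {w l} → x w ≤ toℕ l →
                    HF.inflow (lift x) (combine w l) ≡ inflow x w + x w * bound w
  inflowH-unfired {x} reachable {w} {l} unfired = begin
    sum (λ e → prefixSum (lift x e) (λ j → HF.graphAfter j e e′))
      ≡⟨ sum-cong-≗ (λ e → prefixSum-≤1 (lift x e) _ (below-≤1 (toℕ (levelOf e)) (x (vertexOf e)))) ⟩
    sum (λ e → lift x e * HF.graphAfter 0 e e′)
      ≡⟨ sum-combine n K (λ e → lift x e * HF.graphAfter 0 e e′) ⟩
    sum {n} (λ w₁ → sum {K} (λ l₁ → lift x (combine w₁ l₁) * HF.graphAfter 0 (combine w₁ l₁) e′))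
      ≡⟨ sum-cong-≗ (λ w₁ → sum-cong-≗ (λ l₁ →
           trans (cong₂ _*_ (lift-combine x w₁ l₁) (graphH-combine w₁ l₁ e′))
                 (fired-edge (Reachable-Active reachable) unfired w₁ l₁))) ⟩
    sum {n} (λ w₁ → sum {K} (λ l₁ → below (toℕ l₁) (x w₁) * row w₁ l₁ w))
      ≡⟨ sum-cong-≗ (λ w₁ → sum-below K (m≤n⇒m≤1+n (Reachable-≤-L reachable w₁)) _) ⟩
    sum {n} (λ w₁ → prefixSum (x w₁) (λ j → graphAfter j w₁ w + δ w w₁ (bound w₁)))
      ≡⟨ sum-cong-≗ (λ w₁ → split w₁) ⟩
    sum {n} (λ w₁ → prefixSum (x w₁) (λ j → graphAfter j w₁ w) + δ w w₁ (x w₁ * bound w₁))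
      ≡⟨ ∑-distrib-+ (λ w₁ → prefixSum (x w₁) (λ j → graphAfter j w₁ w)) _ ⟩
    inflow x w + sum {n} (λ w₁ → δ w w₁ (x w₁ * bound w₁))
      ≡⟨ cong (inflow x w +_) (sum-δˡ w (λ u → x u * bound u)) ⟩
    inflow x w + x w * bound w ∎
    where
    open ≡-Reasoning
    e′ = combine w l
    split : ∀ w₁ → prefixSum (x w₁) (λ j → graphAfter j w₁ w + δ w w₁ (bound w₁))
                 ≡ prefixSum (x w₁) (λ j → graphAfter j w₁ w) + δ w w₁ (x w₁ * bound w₁)
    split w₁ = trans (prefixSum-+ (x w₁) _ _)
                     (cong (prefixSum (x w₁) (λ j → graphAfter j w₁ w) +_)
                           (trans (prefixSum-const (x w₁) _) (*-δ w w₁ (x w₁) (bound w₁))))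

  incomeH-unfired : ∀ {x} → Reachable x → ∀ {w l} → x w ≤ toℕ l →
                    HF.income (lift x) (combine w l) ≡
                    K * degAfter (toℕ l) w + K * bound w + (income x w + x w * bound w)
  incomeH-unfired {x} reachable {w} {l} unfired = begin
    chips H (combine w l) + HF.inflow (lift x) (combine w l)
      ≡⟨ cong₂ _+_ (chipsH-combine w l) (inflowH-unfired reachable unfired) ⟩
    A + chips G w + (inflow x w + x w * bound w)
      ≡⟨ +-assoc A (chips G w) _ ⟩
    A + (chips G w + (inflow x w + x w * bound w))
      ≡⟨ cong (A +_) (+-assoc (chips G w) _ _) ⟨
    A + (income x w + x w * bound w) ∎
    where
    open ≡-Reasoning
    A = K * degAfter (toℕ l) w + K * bound w

  FireableH-unfired⇒ : ∀ {x} → Reachable x → ∀ {w l} → x w ≤ toℕ l →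
                       HF.Fireable (lift x) (combine w l) →
                       0 < degAfter (toℕ l) w × threshold w l ≤ income x w + x w * bound w
  FireableH-unfired⇒ {x} reachable {w} {l} unfired fireable = d>0 , +-cancelˡ-≤ A _ _ A+P≤A+income
    where
    e = combine w l
    d = degAfter (toℕ l) w
    A = K * d + K * bound w
    level0 : 0 < HF.degAfter 0 e × HF.degAfter 0 e ≤ HF.income (lift x) e
    level0 = subst (λ k → 0 < HF.degAfter k e × HF.sent (suc k) e ≤ HF.income (lift x) e)
                   (trans (lift-combine x w l) (below-≥ unfired)) fireable
    d>0 : 0 < d
    d>0 = 1⊓m*n>0⇒m>0 d (subst (0 <_) (degH-combine w l) (proj₁ level0))
    A+P≤A+income : A + threshold w l ≤ A + (income x w + x w * bound w)
    A+P≤A+income = subst₂ _≤_ (trans (degH-combine w l) (m>0⇒1⊓m*n≡n _ d>0)) (incomeH-unfired reachable unfired)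
                          (proj₂ level0)

  FireableH-unfired⇐ : ∀ {x} → Reachable x → ∀ {w l} → x w ≤ toℕ l →
                       0 < degAfter (toℕ l) w → threshold w l ≤ income x w + x w * bound w →
                       HF.Fireable (lift x) (combine w l)
  FireableH-unfired⇐ {x} reachable {w} {l} unfired d>0 P≤income =
    subst (λ k → 0 < HF.degAfter k e × HF.sent (suc k) e ≤ HF.income (lift x) e)
          (sym (trans (lift-combine x w l) (below-≥ unfired)))
          (subst (0 <_) (sym degree≡) (<-≤-trans (s≤s z≤n) (≤-trans (m≤n+m (K * bound w) (K * d)) (m≤m+n A _))) ,
           subst₂ _≤_ (sym degree≡) (sym (incomeH-unfired reachable unfired)) (+-monoʳ-≤ A P≤income))
    where
    e = combine w l
    d = degAfter (toℕ l) w
    A = K * d + K * bound w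
    degree≡ : HF.degAfter 0 e ≡ A + threshold w l
    degree≡ = trans (degH-combine w l) (m>0⇒1⊓m*n≡n _ d>0)

  FireableH⇒Fireable : ∀ {x} → Reachable x → ∀ w l → HF.Fireable (lift x) (combine w l) →
                       toℕ l ≡ x w × Fireable x w
  FireableH⇒Fireable {x} reachable w l fireable with x w ≤? toℕ l
  ... | no  x≰l = ⊥-elim (<-irrefl refl (subst (0 <_) (degH-suc 0 e)
                    (subst (λ k → 0 < HF.degAfter k e) (trans (lift-combine x w l) (below-< (≰⇒> x≰l)))
                           (proj₁ fireable))))
    where e = combine w l
  ... | yes unfired with FireableH-unfired⇒ reachable unfired fireable
  ...   | d>0 , P≤income with digit-forced (income<bound reachable w) unfired P≤income
  ...     | l≡x , enough = l≡x , subst (λ k → 0 < degAfter k w × sent (suc k) w ≤ income x w) l≡x (d>0 , enough)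

  target : (Fin n → ℕ) → Fin n → Fin m
  target x w = combine w (clamp L (x w))

  Fireable⇒FireableH : ∀ {x} → Reachable x → ∀ w → Fireable x w → HF.Fireable (lift x) (target x w)
  Fireable⇒FireableH {x} reachable w (d>0 , enough) =
    FireableH-unfired⇐ reachable (≤-reflexive (sym l≡x))
      (subst (λ k → 0 < degAfter k w) (sym l≡x) d>0)
      (subst₂ _≤_ (cong₂ _+_ (cong (bound w *_) (sym l≡x)) (cong (λ k → sent (suc k) w) (sym l≡x)))
                  (+-comm (x w * bound w) (income x w))
                  (+-mono-≤ (≤-reflexive (*-comm (bound w) (x w))) enough))
    where
    l≡x : toℕ (clamp L (x w)) ≡ x w
    l≡x = toℕ-clamp (Reachable-≤-L reachable w)

  lift-inc : ∀ {x} → Reachable x → ∀ w → inc (lift x) (target x w) ≗ lift (inc x w)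
  lift-inc {x} reachable w e with e ≟ target x w
  ... | yes refl = begin
    suc (lift x (target x w))                  ≡⟨ cong suc (lift-combine x w c) ⟩
    suc (below (toℕ c) (x w))                  ≡⟨ cong suc (below-≥ (≤-reflexive (sym c≡x))) ⟩
    1                                          ≡⟨ below-< (≤-reflexive (cong suc c≡x)) ⟨
    below (toℕ c) (suc (x w))                  ≡⟨ cong (below (toℕ c)) (inc-self x w) ⟨
    below (toℕ c) (inc x w w)                  ≡⟨ lift-combine (inc x w) w c ⟨
    lift (inc x w) (target x w)                ∎
    where
    open ≡-Reasoning
    c = clamp L (x w)
    c≡x = toℕ-clamp (Reachable-≤-L reachable w)
  ... | no e≢target with vertexOf e ≟ w
  ...   | no  _    = refl
  ...   | yes refl = below-suc l≢x
    where
    l≢x : ¬ toℕ (levelOf e) ≡ x w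
    l≢x l≡x = e≢target (trans (sym (combine-vertexOf-levelOf e))
                (cong (combine w) (FP.toℕ-injective (trans l≡x (sym (toℕ-clamp (Reachable-≤-L reachable w)))))))

  liftSeq : (Fin n → ℕ) → List (Fin n) → List (Fin m)
  liftSeq x []       = []
  liftSeq x (w ∷ ws) = target x w ∷ liftSeq (inc x w) ws

  Playable-lift : ∀ {x} → Reachable x → ∀ ws → Playable x ws →
                  HF.Playable (lift x) (liftSeq x ws) × incAll (lift x) (liftSeq x ws) ≗ lift (incAll x ws)
  Playable-lift reachable []       _ = tt , λ _ → refl
  Playable-lift {x} reachable (w ∷ ws) (fireable , playable) =
    (Fireable⇒FireableH reachable w fireable , HF.Playable-cong (λ e → sym (lift-inc reachable w e)) _ playableᴴ) ,
    λ e → trans (incAll-cong (lift-inc reachable w) (liftSeq (inc x w) ws) e) (end e)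
    where
    rest = Playable-lift (Reachable-inc reachable w fireable) ws playable
    playableᴴ = proj₁ rest
    end = proj₂ rest

  Playable-unlift : ∀ {x} → Reachable x → ∀ {z} → z ≗ lift x → ∀ es → HF.Playable z es →
                    Σ (List (Fin n)) λ ws → Playable x ws × incAll z es ≗ lift (incAll x ws)
  Playable-unlift reachable z≗x []       _                     = [] , tt , z≗x
  Playable-unlift {x} reachable {z} z≗x (e ∷ es) (fireable , playable) =
    w ∷ ws , (fireableᴳ , playableᴳ) , end
    where
    w = vertexOf e
    l = levelOf e
    forced = FireableH⇒Fireable reachable w l
               (subst (HF.Fireable (lift x)) (sym (combine-vertexOf-levelOf e)) (HF.Fireable-cong z≗x e fireable))
    fireableᴳ = proj₂ forced
    e≡target : e ≡ target x w
    e≡target = trans (sym (combine-vertexOf-levelOf e))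
                     (cong (combine w) (FP.toℕ-injective (trans (proj₁ forced)
                                                                (sym (toℕ-clamp (Reachable-≤-L reachable w))))))
    inc-z≗ : inc z e ≗ lift (inc x w)
    inc-z≗ u = trans (inc-cong z≗x e u) (trans (cong (λ t → inc (lift x) t u) e≡target) (lift-inc reachable w u))
    rest = Playable-unlift (Reachable-inc reachable w fireableᴳ) inc-z≗ es playable
    ws = proj₁ rest
    playableᴳ = proj₁ (proj₂ rest)
    end = proj₂ (proj₂ rest)

  lift-cong : ∀ {x y} → x ≗ y → lift x ≗ lift y
  lift-cong x≗y e = cong (below (toℕ (levelOf e))) (x≗y (vertexOf e))

  lift-mono : ∀ {x y} → x ≤̇ y → lift x ≤̇ lift y
  lift-mono x≤y e = below-monoʳ-≤ (toℕ (levelOf e)) (x≤y (vertexOf e))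

  lift-reflects-≤̇ : ∀ {x y} → Reachable y → lift x ≤̇ lift y → x ≤̇ y
  lift-reflects-≤̇ {x} {y} reachableʸ lift≤ w with x w ≤? y w
  ... | yes x≤y = x≤y
  ... | no  x≰y = ⊥-elim (1+n≰n (subst₂ _≤_ lift-x≡1 lift-y≡0 (lift≤ (target y w))))
    where
    c≡y = toℕ-clamp (Reachable-≤-L reachableʸ w)
    lift-x≡1 : lift x (target y w) ≡ 1
    lift-x≡1 = trans (lift-combine x w _) (below-< (subst (_< x w) (sym c≡y) (≰⇒> x≰y)))
    lift-y≡0 : lift y (target y w) ≡ 0
    lift-y≡0 = trans (lift-combine y w _) (below-≥ (≤-reflexive (sym c≡y)))

  lift-injective : ∀ {x y} → Reachable x → Reachable y → lift x ≗ lift y → x ≗ y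
  lift-injective {x} {y} reachableˣ reachableʸ lift≗ w =
    ≤-antisym (lift-reflects-≤̇ {x} reachableʸ (λ e → ≤-reflexive (lift≗ e)) w)
              (lift-reflects-≤̇ {y} reachableˣ (λ e → ≤-reflexive (sym (lift≗ e))) w)

  final-Reachable : Reachable final
  final-Reachable = fs , fs-playable , λ _ → refl

  fsᴴ : List (Fin m)
  fsᴴ = liftSeq zeros fs

  fsᴴ-playable : HF.Playable zeros fsᴴ
  fsᴴ-playable = proj₁ (Playable-lift Reachable-zeros fs fs-playable)

  fsᴴ-stuck : HF.Stuck (incAll zeros fsᴴ)
  fsᴴ-stuck e fireable = fs-stuck (vertexOf e) (proj₂ (FireableH⇒Fireable final-Reachable (vertexOf e) (levelOf e)
    (subst (HF.Fireable (lift final)) (sym (combine-vertexOf-levelOf e))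
           (HF.Fireable-cong (proj₂ (Playable-lift Reachable-zeros fs fs-playable)) e fireable))))

  H-simple : Simple H
  H-simple = HF.stuck⇒Convergent fsᴴ fsᴴ-playable fsᴴ-stuck ,
             λ es (legal , _) → HF.Playable-Unique degH-suc zeros es
               (HF.Legal⇒Playable zeros es HF.Solvent-zeros (Legal-cong HF.initial≈positionAt-zeros es legal))

  module HC = HF.Convergence fsᴴ fsᴴ-playable fsᴴ-stuck

  toH : Config G → Config H
  toH c = HF.configOf (liftSeq zeros (proj₁ (proj₂ c)))
                      (proj₁ (Playable-lift Reachable-zeros _ (config-Playable c)))

  firingVector-toH : ∀ c → HF.firingVector (toH c) ≗ lift (firingVector c)
  firingVector-toH c = proj₂ (Playable-lift Reachable-zeros _ (config-Playable c))

  toH-surjective : ∀ d → Σ (Config G) λ c → ∀ {c′} → c′ ≈C c → toH c′ ≈C d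
  toH-surjective d = configOf ws playable , λ {c′} c′≈c →
    HF.≗⇒≈C (toH c′) d (λ e → trans (firingVector-toH c′ e)
                                 (trans (lift-cong (≈C⇒≗ c′ (configOf ws playable) c′≈c) e) (sym (end e))))
    where
    unlifted = Playable-unlift Reachable-zeros (λ _ → refl) _ (HF.config-Playable d)
    ws = proj₁ unlifted
    playable = proj₁ (proj₂ unlifted)
    end = proj₂ (proj₂ unlifted)

  toH-isOrderIsomorphism : IsOrderIsomorphism (_≈C_ {G = G}) (_≈C_ {G = H}) (_≤C_ {G = G}) (_≤C_ {G = H}) toH
  toH-isOrderIsomorphism = record
    { isOrderMonomorphism = record
      { isOrderHomomorphism = record
        { cong = λ {c} {d} c≈d → HF.≗⇒≈C (toH c) (toH d) (λ e →
            trans (firingVector-toH c e) (trans (lift-cong (≈C⇒≗ c d c≈d) e) (sym (firingVector-toH d e))))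
        ; mono = λ {c} {d} c≤d → HC.≤̇⇒≤C (toH c) (toH d) (λ e →
            subst₂ _≤_ (sym (firingVector-toH c e)) (sym (firingVector-toH d e)) (lift-mono (≤C⇒≤̇ c d c≤d) e))
        }
      ; injective = λ {c} {d} hc≈hd → ≗⇒≈C c d (lift-injective (config-Reachable c) (config-Reachable d) (λ e →
          trans (sym (firingVector-toH c e)) (trans (HC.≈C⇒≗ (toH c) (toH d) hc≈hd e) (firingVector-toH d e))))
      ; cancel = λ {c} {d} hc≤hd → ≤̇⇒≤C c d (lift-reflects-≤̇ (config-Reachable d) (λ e →
          subst₂ _≤_ (firingVector-toH c e) (firingVector-toH d e) (HC.≤C⇒≤̇ (toH c) (toH d) hc≤hd e)))
      }
    ; surjective = toH-surjective
    }

theorem2 : ∀ {n} (G : MCFG n) → Convergent G →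
    ∃[ m ] ∃[ H ] (Simple {m} H × Equivalent G H)
theorem2 G convergent with FiringVectors.stuckExecution G convergent
... | fs , playable , stuck = m , H , H-simple , toH , toH-isOrderIsomorphism
  where open SimpleGame G fs playable stuck
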